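{- Let $k\geq n/2+1$, $x\in[n]^{(k)}$, and let $i_1<\dots<i_t$ be the elements of $x\cap *(x)$. Let $b\in x$ and $y=x\setminus\{b\}$. Then $y<x$ if and only if $b=i_u$ for some $u\in\{1,\dots,2k-n\}$.
   Context: For $x\subseteq[n]$ and $1\le i\le j\le n$ let $c_x(i,j)=|x\cap[i,j]|-|[i,j]\setminus x|$, $[i,j]=\{i,\dots,j\}$. The signature $sg(x)\in\{0,1,*\}^n$: if $i\in x$ and some $j$ with $i<j\le n$ has $c_x(i,j)=0$ then $sg(x)_i=1$, else $sg(x)_i=*$; if $i\notin x$ and some $j$ with $1\le j<i$ has $c_x(j,i)=0$ then $sg(x)_i=0$, else $sg(x)_i=*$. Let $*(x)=\{i:sg(x)_i=*\}$. Let $x\sim y$ iff $sg(x)=sg(y)$; each class is a symmetric chain in $2^{[n]}$. Let $Q=[n]^{(\ge n/2)}$; for $x\in Q$, $p(x)$ is the unique element of the $\sim$-class of $x$ with $|x|+|p(x)|=n$. For $x,y\in Q$, $y<x$ iff $y\ne x$ and $p(x)\subseteq p(y)\subseteq y\subseteq x$. -}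

module Defs where

open import Data.Nat as ℕ using (ℕ; _+_; _*_; _∸_)
open import Data.Integer as ℤ using (ℤ; +_; _-_)
open import Data.Bool using (Bool; true; false; _∧_; not)
open import Data.Fin using (Fin; toℕ; _<_; _≤_; _<?_; _≤?_)
open import Data.Fin.Properties using (any?)
open import Data.Fin.Subset using (Subset; _∈_; _∉_; _⊆_; ∣_∣)
open import Data.Fin.Subset.Properties using (_∈?_)
open import Data.Vec using (Vec; lookup; tabulate)
open import Data.List using (List; filter; length; allFin; take)
open import Data.Product using (Σ; ∃; _×_; _,_)
open import Relation.Nullary using (Dec; yes; no; ¬_; does)
open import Relation.Nullary.Decidable using (_×-dec_; ¬?)
open import Relation.Binary.PropositionalEquality using (_≡_)
import Data.Integer.Properties as ℤP

-- Ground set [n] is represented by Fin n (0-based, order preserved).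
-- Subsets of [n] are Data.Fin.Subset (Vec Bool n).

c : ∀ {n} → Subset n → Fin n → Fin n → ℤ
c {n} x i j =
  + length (filter (λ l → (i ≤? l) ×-dec ((l ≤? j) ×-dec (l ∈? x))) (allFin n))
  - + length (filter (λ l → (i ≤? l) ×-dec ((l ≤? j) ×-dec ¬? (l ∈? x))) (allFin n))

data Sym : Set where
  s0 s1 s* : Sym

sgAt : ∀ {n} → Subset n → Fin n → Sym
sgAt x i with i ∈? x
... | yes _ with any? (λ j → (i <? j) ×-dec (c x i j ℤP.≟ + 0))
...   | yes _ = s1
...   | no  _ = s*
sgAt x i | no _ with any? (λ j → (j <? i) ×-dec (c x j i ℤP.≟ + 0))
...   | yes _ = s0
...   | no  _ = s*

sg : ∀ {n} → Subset n → Vec Sym n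
sg x = tabulate (sgAt x)

IsStar : ∀ {n} → Subset n → Fin n → Set
IsStar x i = sgAt x i ≡ s*

isStar? : ∀ {n} (x : Subset n) (i : Fin n) → Dec (IsStar x i)
isStar? x i with sgAt x i
... | s0 = no (λ ())
... | s1 = no (λ ())
... | s* = yes _≡_.refl

_∼_ : ∀ {n} → Subset n → Subset n → Set
x ∼ y = sg x ≡ sg y

InQ : ∀ {n} → Subset n → Set
InQ {n} x = n ℕ.≤ 2 * ∣ x ∣

-- IsP x z : z is "p(x)", the element of the ∼-class of x with |x|+|z| = n
IsP : ∀ {n} → Subset n → Subset n → Set
IsP {n} x z = (z ∼ x) × (∣ x ∣ + ∣ z ∣ ≡ n)

_≺_ : ∀ {n} → Subset n → Subset n → Set
y ≺ x = ¬ (y ≡ x) × Σ _ λ px → Σ _ λ py →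
          IsP x px × IsP y py × px ⊆ py × py ⊆ y × y ⊆ x

starElems : ∀ {n} → Subset n → List (Fin n)
starElems {n} x = filter (λ i → (i ∈? x) ×-dec isStar? x i) (allFin n)

module Submission where

-- Read a subset z of [n] as a lattice path (up at members, down elsewhere) with
-- height function `height z`; then c z i j is a height increment and the
-- signature becomes geometric: a member is starred iff the path stays strictly
-- above its height afterwards, a non-member iff its down step reaches a new low.
-- Hence (i) starred members are the last visits of the levels 0, 1, …, so there
-- are at least 2|z| − n of them; (ii) deleting the first starred member keeps
-- the signature, so deleting the first 2|z| − n of them yields p(z); (iii)
-- deleting a starred member b destroys at most one further starred member.
-- (⇒) p(x) ⊆ x - b has the signature of x and misses b, so it misses every
-- starred member up to b, which bounds the rank of b.  (⇐) The sets p(x) and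
-- p(x - b) given by (ii) are nested by (iii).

open import Defs
open import Function using (_∘_)
open import Function.Bundles using (_⇔_; mk⇔)
open import Data.Empty using (⊥; ⊥-elim)
open import Data.Bool using (Bool; true; false)
open import Data.Product using (∃; _×_; _,_; proj₁; proj₂)
open import Data.Sum using (_⊎_; inj₁; inj₂; [_,_]′)
open import Data.Nat as ℕ using (ℕ; zero; suc; _+_; _*_; _∸_; _≤_; _<_; z≤n; s≤s)
import Data.Nat.Properties as ℕP
open import Data.Integer as ℤ using (ℤ; +_; 0ℤ; 1ℤ; -1ℤ)
import Data.Integer.Properties as ℤP
open import Data.Integer.Tactic.RingSolver using (solve-∀)
open import Data.Fin as F using (Fin; toℕ; fromℕ<)
import Data.Fin.Properties as FP
open import Data.Fin.Subset using (Subset; _∈_; _∉_; _⊆_; inside; outside; _-_; ⁅_⁆; ∣_∣)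
open import Data.Fin.Subset.Properties using (_∈?_; drop-there; p─⊥≡p; p─q⊆p; x∈p∧x≢y⇒x∈p-y)
open import Data.Vec as V using ([]; _∷_; here; there)
open import Data.Vec.Properties using (tabulate-cong; lookup∘tabulate)
open import Data.List using (List; []; _∷_; filter; length; tabulate; allFin; take; lookup)
open import Data.List.Properties using (filter-accept; filter-reject; filter-≐; filter-none; filter-some)
open import Data.List.Membership.Propositional using () renaming (_∈_ to _∈ˡ_)
open import Data.List.Membership.Propositional.Properties using (∈-filter⁺; ∈-filter⁻; ∈-allFin)
import Data.List.Relation.Unary.All as All
open import Data.List.Relation.Unary.Any using (here; there; index)
open import Data.List.Relation.Unary.Any.Properties using (lookup-index)
open import Data.List.Relation.Unary.AllPairs using (AllPairs; []; _∷_)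
import Data.List.Relation.Unary.AllPairs.Properties as APP
open import Data.List.Relation.Unary.Unique.Propositional using (Unique)
open import Data.List.Relation.Unary.Unique.Propositional.Properties using (allFin⁺)
open import Relation.Nullary using (Dec; yes; no; ¬_; does)
open import Relation.Nullary.Decidable using (_×-dec_; _⊎-dec_; ¬?; decidable-stable)
open import Relation.Unary using (Decidable)
open import Relation.Binary.Definitions using (tri<; tri≈; tri>)
open import Relation.Binary.PropositionalEquality
  using (_≡_; _≢_; refl; sym; trans; cong; cong₂; subst; subst₂; module ≡-Reasoning)

count : ∀ {A : Set} {P : A → Set} → Decidable P → List A → ℕ
count P? xs = length (filter P? xs)

count-≐ : ∀ {A : Set} {P Q : A → Set} (P? : Decidable P) (Q? : Decidable Q) →
  (∀ {a} → P a → Q a) → (∀ {a} → Q a → P a) → ∀ xs → count P? xs ≡ count Q? xs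
count-≐ P? Q? P⇒Q Q⇒P xs = cong length (filter-≐ P? Q? (P⇒Q , Q⇒P) xs)

count-tabulate : ∀ {A : Set} {P : A → Set} (P? : Decidable P) n (f : Fin n → A) →
  count P? (tabulate f) ≡ count (λ l → P? (f l)) (allFin n)
count-tabulate P? zero f = refl
count-tabulate P? (suc n) f with does (P? (f F.zero))
... | true  = cong suc (trans (count-tabulate P? n (λ l → f (F.suc l)))
                               (sym (count-tabulate (λ l → P? (f l)) n F.suc)))
... | false = trans (count-tabulate P? n (λ l → f (F.suc l)))
                    (sym (count-tabulate (λ l → P? (f l)) n F.suc))

count-none : ∀ {A : Set} {P : A → Set} (P? : Decidable P) → (∀ a → ¬ P a) → ∀ xs → count P? xs ≡ 0
count-none P? ¬P xs = cong length (filter-none P? (All.universal ¬P xs))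

count-cover : ∀ {A : Set} {P Q R : A → Set} (P? : Decidable P) (Q? : Decidable Q) (R? : Decidable R) →
  (∀ {a} → P a → Q a ⊎ R a) → ∀ xs → count P? xs ≤ count Q? xs + count R? xs
count-cover P? Q? R? cover []       = z≤n
count-cover P? Q? R? cover (x ∷ xs) with P? x | Q? x | R? x | count-cover P? Q? R? cover xs
... | no _  | no _  | no _  | ih = ih
... | no _  | yes _ | no _  | ih = ℕP.m≤n⇒m≤1+n ih
... | no _  | no _  | yes _ | ih = ℕP.≤-trans ih (ℕP.+-monoʳ-≤ _ (ℕP.n≤1+n _))
... | no _  | yes _ | yes _ | ih = ℕP.≤-trans ih (ℕP.≤-trans (ℕP.+-monoʳ-≤ _ (ℕP.n≤1+n _)) (ℕP.n≤1+n _))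
... | yes _ | yes _ | no _  | ih = s≤s ih
... | yes _ | yes _ | yes _ | ih = s≤s (ℕP.≤-trans ih (ℕP.+-monoʳ-≤ _ (ℕP.n≤1+n _)))
... | yes _ | no _  | yes _ | ih = ℕP.≤-trans (s≤s ih) (ℕP.≤-reflexive (sym (ℕP.+-suc _ _)))
... | yes p | no ¬q | no ¬r | _  = ⊥-elim ([ ¬q , ¬r ]′ (cover p))

count-disjoint : ∀ {A : Set} {P Q R : A → Set} (P? : Decidable P) (Q? : Decidable Q) (R? : Decidable R) →
  (∀ {a} → P a → Q a → ⊥) → (∀ {a} → P a ⊎ Q a → R a) →
  ∀ xs → count P? xs + count Q? xs ≤ count R? xs
count-disjoint P? Q? R? disjoint into []       = z≤n
count-disjoint P? Q? R? disjoint into (x ∷ xs) with P? x | Q? x | R? x | count-disjoint P? Q? R? disjoint into xs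
... | yes p | yes q | _     | _  = ⊥-elim (disjoint p q)
... | yes _ | no _  | yes _ | ih = s≤s ih
... | no _  | yes _ | yes _ | ih = ℕP.≤-trans (ℕP.≤-reflexive (ℕP.+-suc _ _)) (s≤s ih)
... | no _  | no _  | yes _ | ih = ℕP.m≤n⇒m≤1+n ih
... | no _  | no _  | no _  | ih = ih
... | yes p | no _  | no ¬r | _  = ⊥-elim (¬r (into (inj₁ p)))
... | no _  | yes q | no ¬r | _  = ⊥-elim (¬r (into (inj₂ q)))

count-≤1 : ∀ {A : Set} {P : A → Set} (P? : Decidable P) → (∀ {a b} → P a → P b → a ≡ b) →
  ∀ {xs} → Unique xs → count P? xs ≤ 1
count-≤1 P? unique-witness {[]}     []              = z≤n
count-≤1 P? unique-witness {x ∷ xs} (x∉xs ∷ unique) with P? x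
... | yes p = s≤s (ℕP.≤-reflexive (cong length (filter-none P? (All.map (λ x≢a pa → x≢a (unique-witness p pa)) x∉xs))))
... | no _  = count-≤1 P? unique-witness unique

count-filter : ∀ {A : Set} {P Q : A → Set} (P? : Decidable P) (Q? : Decidable Q) xs →
  count Q? (filter P? xs) ≡ count (λ a → Q? a ×-dec P? a) xs
count-filter P? Q? []       = refl
count-filter P? Q? (x ∷ xs) with P? x
... | yes _ with Q? x
...   | yes _ = cong suc (count-filter P? Q? xs)
...   | no _  = count-filter P? Q? xs
count-filter P? Q? (x ∷ xs) | no _ with Q? x
...   | yes _ = count-filter P? Q? xs
...   | no _  = count-filter P? Q? xs

filter-cong-on : ∀ {A : Set} {P Q : A → Set} (P? : Decidable P) (Q? : Decidable Q) xs →
  (∀ {a} → a ∈ˡ xs → P a → Q a) → (∀ {a} → a ∈ˡ xs → Q a → P a) → filter P? xs ≡ filter Q? xs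
filter-cong-on P? Q? []       _   _   = refl
filter-cong-on P? Q? (x ∷ xs) P⇒Q Q⇒P with P? x | Q? x
... | yes _ | yes _ = cong (x ∷_) (filter-cong-on P? Q? xs (P⇒Q ∘ there) (Q⇒P ∘ there))
... | yes p | no ¬q = ⊥-elim (¬q (P⇒Q (here refl) p))
... | no ¬p | yes q = ⊥-elim (¬p (Q⇒P (here refl) q))
... | no _  | no _  = filter-cong-on P? Q? xs (P⇒Q ∘ there) (Q⇒P ∘ there)

filter-drop-head : ∀ {A : Set} {P Q : A → Set} (P? : Decidable P) (Q? : Decidable Q) {xs} → Unique xs →
  ∀ {e rest} → filter P? xs ≡ e ∷ rest →
  (∀ {a} → Q a → P a × a ≢ e) → (∀ {a} → P a → a ≢ e → Q a) → filter Q? xs ≡ rest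
filter-drop-head P? Q? {x ∷ xs} (x∉xs ∷ unique) eq Q⇒P P⇒Q with P? x | Q? x
filter-drop-head P? Q? {x ∷ xs} (x∉xs ∷ unique) refl Q⇒P P⇒Q | yes _ | yes q = ⊥-elim (proj₂ (Q⇒P q) refl)
filter-drop-head P? Q? {x ∷ xs} (x∉xs ∷ unique) refl Q⇒P P⇒Q | yes _ | no _ =
  filter-cong-on Q? P? xs (λ _ q → proj₁ (Q⇒P q))
                          (λ a∈xs p → P⇒Q p (λ a≡x → All.lookup x∉xs a∈xs (sym a≡x)))
... | no ¬p | yes q = ⊥-elim (¬p (proj₁ (Q⇒P q)))
... | no _  | no _  = filter-drop-head P? Q? unique eq Q⇒P P⇒Q

rank : ∀ {n} → Fin n → List (Fin n) → ℕ
rank a xs = count (F._<? a) xs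

∈-take⇒ : ∀ {n} {xs : List (Fin n)} → AllPairs F._<_ xs → ∀ {a} r → a ∈ˡ take r xs → a ∈ˡ xs × rank a xs < r
∈-take⇒ {xs = x ∷ xs} (x<xs ∷ _) (suc r) (here refl) =
  here refl , subst (_< suc r) (sym nothing-below) (s≤s z≤n)
  where
  nothing-below : rank x (x ∷ xs) ≡ 0
  nothing-below = cong length (trans (filter-reject (F._<? x) (FP.<-irrefl refl))
                                     (filter-none (F._<? x) (All.map FP.<-asym x<xs)))
∈-take⇒ {xs = x ∷ xs} (x<xs ∷ sorted) (suc r) (there a∈t) =
  let a∈xs , below = ∈-take⇒ sorted r a∈t
  in there a∈xs , subst (_< suc r) (sym (cong length (filter-accept (F._<? _) (All.lookup x<xs a∈xs)))) (s≤s below)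

∈-take⇐ : ∀ {n} {xs : List (Fin n)} → AllPairs F._<_ xs → ∀ {a} r → a ∈ˡ xs → rank a xs < r → a ∈ˡ take r xs
∈-take⇐ {xs = x ∷ xs} _              (suc r) (here refl) _     = here refl
∈-take⇐ {xs = x ∷ xs} (x<xs ∷ sorted) (suc r) (there a∈xs) below =
  there (∈-take⇐ sorted r a∈xs (ℕP.≤-pred (subst (_< suc r) (cong length (filter-accept (F._<? _) x<a)) below)))
  where
  x<a = All.lookup x<xs a∈xs

step : Bool → ℤ
step true  = 1ℤ
step false = -1ℤ

-- height z m is the height of the path after its first m steps, i.e.
-- (#members − #non-members of z) among the positions 0, …, m-1.
height : ∀ {n} → Subset n → ℕ → ℤ
height _       zero    = 0ℤ
height []      (suc m) = 0ℤ
height (s ∷ z) (suc m) = step s ℤ.+ height z m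

bitAt : ∀ {n} → Subset n → ℕ → Bool
bitAt []      _       = false
bitAt (s ∷ z) zero    = s
bitAt (s ∷ z) (suc m) = bitAt z m

bitAt-∈ : ∀ {n} {z : Subset n} {i : Fin n} → i ∈ z → bitAt z (toℕ i) ≡ true
bitAt-∈ here      = refl
bitAt-∈ (there p) = bitAt-∈ p

bitAt-∉ : ∀ {n} {z : Subset n} {i : Fin n} → i ∉ z → bitAt z (toℕ i) ≡ false
bitAt-∉ {z = true  ∷ z} {F.zero}  i∉z = ⊥-elim (i∉z here)
bitAt-∉ {z = false ∷ z} {F.zero}  i∉z = refl
bitAt-∉ {z = s     ∷ z} {F.suc i} i∉z = bitAt-∉ (λ p → i∉z (there p))

bitAt⇒∈ : ∀ {n} (z : Subset n) (i : Fin n) → bitAt z (toℕ i) ≡ true → i ∈ z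
bitAt⇒∈ (true  ∷ z) F.zero    _  = here
bitAt⇒∈ (false ∷ z) F.zero    ()
bitAt⇒∈ (s     ∷ z) (F.suc i) eq = there (bitAt⇒∈ z i eq)

height-step : ∀ {n} (z : Subset n) m → m < n → height z (suc m) ≡ step (bitAt z m) ℤ.+ height z m
height-step (s ∷ z) zero    _          = refl
height-step (s ∷ z) (suc m) (s≤s m<n) =
  trans (cong (ℤ._+_ (step s)) (height-step z m m<n)) (swap (step s) (step (bitAt z m)) (height z m))
  where
  swap : ∀ a b h → a ℤ.+ (b ℤ.+ h) ≡ b ℤ.+ (a ℤ.+ h)
  swap = solve-∀

height-step-∈ : ∀ {n} (z : Subset n) {i} → i ∈ z → height z (suc (toℕ i)) ≡ ℤ.suc (height z (toℕ i))
height-step-∈ z {i} i∈z =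
  trans (height-step z (toℕ i) (FP.toℕ<n i)) (cong (λ b → step b ℤ.+ height z (toℕ i)) (bitAt-∈ i∈z))

height-step-∉ : ∀ {n} (z : Subset n) {i} → i ∉ z → height z (suc (toℕ i)) ≡ ℤ.pred (height z (toℕ i))
height-step-∉ z {i} i∉z =
  trans (height-step z (toℕ i) (FP.toℕ<n i)) (cong (λ b → step b ℤ.+ height z (toℕ i)) (bitAt-∉ i∉z))

countIn : ∀ {n} {Q : Fin n → Set} → Decidable Q → Fin n → Fin n → ℕ
countIn {n} Q? i j = count (λ l → (i F.≤? l) ×-dec ((l F.≤? j) ×-dec Q? l)) (allFin n)

countIn-suc : ∀ {n} {Q : Fin (suc n) → Set} (Q? : Decidable Q) (i j : Fin n) →
  countIn Q? (F.suc i) (F.suc j) ≡ countIn (λ l → Q? (F.suc l)) i j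
countIn-suc {n} Q? i j =
  trans (count-tabulate _ n F.suc)
        (count-≐ _ _ (λ { (s≤s i≤l , s≤s l≤j , q) → i≤l , l≤j , q })
                     (λ { (i≤l , l≤j , q) → s≤s i≤l , s≤s l≤j , q }) (allFin n))

countIn-zero : ∀ {n} {Q : Fin (suc n) → Set} (Q? : Decidable Q) (j : Fin (suc n)) →
  countIn Q? F.zero j ≡ count Q? (F.zero ∷ []) + count (λ l → (F.suc l F.≤? j) ×-dec Q? (F.suc l)) (allFin n)
countIn-zero {n} Q? j with does (Q? F.zero)
... | true  = cong suc (trans (count-tabulate _ n F.suc) (count-≐ _ _ proj₂ (z≤n ,_) (allFin n)))
... | false = trans (count-tabulate _ n F.suc) (count-≐ _ _ proj₂ (z≤n ,_) (allFin n))

countIn-≐ : ∀ {n} {Q R : Fin n → Set} (Q? : Decidable Q) (R? : Decidable R) →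
  (∀ {l} → Q l → R l) → (∀ {l} → R l → Q l) → ∀ i j → countIn Q? i j ≡ countIn R? i j
countIn-≐ {n} Q? R? Q⇒R R⇒Q i j =
  count-≐ _ _ (λ (a , b , q) → a , b , Q⇒R q) (λ (a , b , r) → a , b , R⇒Q r) (allFin n)

countIn-zero-zero : ∀ {n} {Q : Fin (suc n) → Set} (Q? : Decidable Q) →
  countIn Q? F.zero F.zero ≡ count Q? (F.zero ∷ [])
countIn-zero-zero {n} Q? =
  trans (countIn-zero Q? F.zero)
        (trans (cong (λ t → count Q? (F.zero ∷ []) + t) (count-none _ (λ { _ (() , _) }) (allFin n)))
               (ℕP.+-identityʳ _))

countIn-zero-suc : ∀ {n} {Q : Fin (suc (suc n)) → Set} (Q? : Decidable Q) (j : Fin (suc n)) →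
  countIn Q? F.zero (F.suc j) ≡ count Q? (F.zero ∷ []) + countIn (λ l → Q? (F.suc l)) F.zero j
countIn-zero-suc {n} Q? j =
  trans (countIn-zero Q? (F.suc j))
        (cong (λ t → count Q? (F.zero ∷ []) + t)
              (count-≐ (λ l → (F.suc l F.≤? F.suc j) ×-dec Q? (F.suc l))
                       (λ l → (F.zero {n} F.≤? l) ×-dec ((l F.≤? j) ×-dec Q? (F.suc l)))
                       (λ { (s≤s l≤j , q) → z≤n , l≤j , q }) (λ (_ , l≤j , q) → s≤s l≤j , q) (allFin (suc n))))

c-suc : ∀ {n} s (z : Subset n) i j → c (s ∷ z) (F.suc i) (F.suc j) ≡ c z i j
c-suc s z i j = cong₂ (λ a b → + a ℤ.- + b)
  (trans (countIn-suc (_∈? (s ∷ z)) i j) (countIn-≐ _ _ drop-there there i j))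
  (trans (countIn-suc (λ l → ¬? (l ∈? (s ∷ z))) i j)
         (countIn-≐ _ _ (λ ∉ ∈z → ∉ (there ∈z)) (λ ∉ ∈z → ∉ (drop-there ∈z)) i j))

c-head : ∀ {n} s (z : Subset n) →
  + count (_∈? (s ∷ z)) (F.zero ∷ []) ℤ.- + count (λ l → ¬? (l ∈? (s ∷ z))) (F.zero ∷ []) ≡ step s
c-head true  z = refl
c-head false z = refl

c-zero-zero : ∀ {n} s (z : Subset n) → c (s ∷ z) F.zero F.zero ≡ step s
c-zero-zero s z = trans (cong₂ (λ a b → + a ℤ.- + b) (countIn-zero-zero (_∈? (s ∷ z)))
                                                     (countIn-zero-zero (λ l → ¬? (l ∈? (s ∷ z)))))
                        (c-head s z)

c-zero-suc : ∀ {n} s (z : Subset (suc n)) j → c (s ∷ z) F.zero (F.suc j) ≡ step s ℤ.+ c z F.zero j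
c-zero-suc s z j = begin
  c (s ∷ z) F.zero (F.suc j)
    ≡⟨ cong₂ (λ a b → + a ℤ.- + b)
         (trans (countIn-zero-suc (_∈? (s ∷ z)) j)
                (cong (ℕ._+_ a) (countIn-≐ (λ l → F.suc l ∈? (s ∷ z)) (_∈? z) drop-there there F.zero j)))
         (trans (countIn-zero-suc (λ l → ¬? (l ∈? (s ∷ z))) j)
                (cong (ℕ._+_ b) (countIn-≐ (λ l → ¬? (F.suc l ∈? (s ∷ z))) (λ l → ¬? (l ∈? z))
                                        (λ ∉ ∈z → ∉ (there ∈z)) (λ ∉ ∈z → ∉ (drop-there ∈z)) F.zero j))) ⟩
  + (a + m) ℤ.- + (b + q)
    ≡⟨ cong₂ ℤ._-_ (ℤP.pos-+ a m) (ℤP.pos-+ b q) ⟩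
  (+ a ℤ.+ + m) ℤ.- (+ b ℤ.+ + q)
    ≡⟨ regroup (+ a) (+ m) (+ b) (+ q) ⟩
  (+ a ℤ.- + b) ℤ.+ (+ m ℤ.- + q)
    ≡⟨ cong (ℤ._+ c z F.zero j) (c-head s z) ⟩
  step s ℤ.+ c z F.zero j ∎
  where
  open ≡-Reasoning
  a b m q : ℕ
  a = count (_∈? (s ∷ z)) (F.zero ∷ [])
  b = count (λ l → ¬? (l ∈? (s ∷ z))) (F.zero ∷ [])
  m = countIn (_∈? z) F.zero j
  q = countIn (λ l → ¬? (l ∈? z)) F.zero j
  regroup : ∀ a m b q → (a ℤ.+ m) ℤ.- (b ℤ.+ q) ≡ (a ℤ.- b) ℤ.+ (m ℤ.- q)
  regroup = solve-∀

c-height : ∀ {n} (z : Subset n) {i j : Fin n} → i F.≤ j →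
  c z i j ≡ height z (suc (toℕ j)) ℤ.- height z (toℕ i)
c-height (s ∷ z) {F.zero}  {F.zero}  _ = trans (c-zero-zero s z) (drop-zeros (step s))
  where
  drop-zeros : ∀ a → a ≡ (a ℤ.+ 0ℤ) ℤ.- 0ℤ
  drop-zeros = solve-∀
c-height {suc (suc n)} (s ∷ z) {F.zero}  {F.suc j} _ =
  trans (c-zero-suc s z j) (trans (cong (ℤ._+_ (step s)) (c-height z {F.zero} {j} z≤n)) (assoc (step s) _))
  where
  assoc : ∀ a h → a ℤ.+ (h ℤ.- 0ℤ) ≡ (a ℤ.+ h) ℤ.- 0ℤ
  assoc = solve-∀
c-height (s ∷ z) {F.suc i} {F.suc j} (s≤s i≤j) =
  trans (c-suc s z i j) (trans (c-height z i≤j) (cancel (step s) _ _))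
  where
  cancel : ∀ a h g → h ℤ.- g ≡ (a ℤ.+ h) ℤ.- (a ℤ.+ g)
  cancel = solve-∀

height-end : ∀ {n} (z : Subset n) → + n ℤ.+ height z n ≡ + (2 * ∣ z ∣)
height-end []          = refl
height-end {suc n} (true ∷ z) = begin
  + suc n ℤ.+ (1ℤ ℤ.+ height z n)        ≡⟨ cong (ℤ._+ (1ℤ ℤ.+ height z n)) (ℤP.pos-+ 1 n) ⟩
  (1ℤ ℤ.+ + n) ℤ.+ (1ℤ ℤ.+ height z n)   ≡⟨ regroup (+ n) (height z n) ⟩
  + 2 ℤ.+ (+ n ℤ.+ height z n)           ≡⟨ cong (ℤ._+_ (+ 2)) (height-end z) ⟩
  + 2 ℤ.+ + (2 * ∣ z ∣)                  ≡⟨ ℤP.pos-+ 2 (2 * ∣ z ∣) ⟨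
  + (2 + 2 * ∣ z ∣)                      ≡⟨ cong +_ (ℕP.*-distribˡ-+ 2 1 ∣ z ∣) ⟨
  + (2 * suc ∣ z ∣)                      ∎
  where
  open ≡-Reasoning
  regroup : ∀ m h → (1ℤ ℤ.+ m) ℤ.+ (1ℤ ℤ.+ h) ≡ + 2 ℤ.+ (m ℤ.+ h)
  regroup = solve-∀
height-end {suc n} (false ∷ z) = begin
  + suc n ℤ.+ (-1ℤ ℤ.+ height z n)       ≡⟨ cong (ℤ._+ (-1ℤ ℤ.+ height z n)) (ℤP.pos-+ 1 n) ⟩
  (1ℤ ℤ.+ + n) ℤ.+ (-1ℤ ℤ.+ height z n)  ≡⟨ cancel (+ n) (height z n) ⟩
  + n ℤ.+ height z n                     ≡⟨ height-end z ⟩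
  + (2 * ∣ z ∣)                          ∎
  where
  open ≡-Reasoning
  cancel : ∀ m h → (1ℤ ℤ.+ m) ℤ.+ (-1ℤ ℤ.+ h) ≡ m ℤ.+ h
  cancel = solve-∀

height-final : ∀ {n} (z : Subset n) → n ≤ 2 * ∣ z ∣ → height z n ≡ + (2 * ∣ z ∣ ∸ n)
height-final {n} z n≤2k = begin
  height z n                              ≡⟨ isolate (+ n) (height z n) ⟩
  (+ n ℤ.+ height z n) ℤ.- + n            ≡⟨ cong (ℤ._- + n) (height-end z) ⟩
  + (2 * ∣ z ∣) ℤ.- + n                   ≡⟨ ℤP.[+m]-[+n]≡m⊖n (2 * ∣ z ∣) n ⟩
  (2 * ∣ z ∣) ℤ.⊖ n                       ≡⟨ ℤP.⊖-≥ n≤2k ⟩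
  + (2 * ∣ z ∣ ∸ n)                       ∎
  where
  open ≡-Reasoning
  isolate : ∀ m h → h ≡ (m ℤ.+ h) ℤ.- m
  isolate = solve-∀

count-∈-suc : ∀ {n} s (z : Subset n) → count (λ l → F.suc l ∈? (s ∷ z)) (allFin n) ≡ count (_∈? z) (allFin n)
count-∈-suc {n} s z = count-≐ (λ l → F.suc l ∈? (s ∷ z)) (_∈? z) drop-there there (allFin n)

card-count : ∀ {n} (z : Subset n) → count (_∈? z) (allFin n) ≡ ∣ z ∣
card-count []                  = refl
card-count {suc n} (true  ∷ z) =
  cong suc (trans (count-tabulate (_∈? (true ∷ z)) n F.suc) (trans (count-∈-suc true z) (card-count z)))
card-count {suc n} (false ∷ z) =
  trans (count-tabulate (_∈? (false ∷ z)) n F.suc) (trans (count-∈-suc false z) (card-count z))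

i<suc[i] : ∀ i → i ℤ.< ℤ.suc i
i<suc[i] i = ℤP.suc[i]≤j⇒i<j ℤP.≤-refl

pred[i]<i : ∀ i → ℤ.pred i ℤ.< i
pred[i]<i i = ℤP.i≤pred[j]⇒i<j ℤP.≤-refl

sucℤ-injective : ∀ {a b} → ℤ.suc a ≡ ℤ.suc b → a ≡ b
sucℤ-injective {a} {b} eq = trans (sym (ℤP.pred-suc a)) (trans (cong ℤ.pred eq) (ℤP.pred-suc b))

UnitSteps : (ℕ → ℤ) → ℕ → Set
UnitSteps f n = ∀ m → m < n → ∃ λ b → f (suc m) ≡ step b ℤ.+ f m

height-unitSteps : ∀ {n} (z : Subset n) → UnitSteps (height z) n
height-unitSteps z m m<n = bitAt z m , height-step z m m<n

step-from-above : ∀ b {v h} → v ℤ.< h → v ℤ.≤ step b ℤ.+ h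
step-from-above true  v<h = ℤP.i≤j⇒i≤1+j (ℤP.<⇒≤ v<h)
step-from-above false v<h = ℤP.i<j⇒i≤pred[j] v<h

step-to-above : ∀ b {v h} → v ℤ.< step b ℤ.+ h → v ℤ.≤ h
step-to-above true  {h = h} v<h+1 = subst (_ ℤ.≤_) (ℤP.pred-suc h) (ℤP.i<j⇒i≤pred[j] v<h+1)
step-to-above false         v<h-1 = ℤP.<⇒≤ (ℤP.<-≤-trans v<h-1 (ℤP.i≤j⇒pred[i]≤j ℤP.≤-refl))

-- Discrete intermediate value theorem, forwards: a walk that starts above v
-- and never visits v on (a, n] stays above v on [a, n].
climb-forward : ∀ {f n a v} → UnitSteps f n → v ℤ.< f a → (∀ m → a < m → m ≤ n → f m ≢ v) →
  ∀ m → a ≤ m → m ≤ n → v ℤ.< f m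
climb-forward unit v<fa avoid m a≤m m≤n with ℕP.m≤n⇒m<n∨m≡n a≤m
... | inj₂ refl = v<fa
climb-forward unit v<fa avoid (suc m) _ m<n | inj₁ (s≤s a≤m) with unit m m<n
... | b , eq = ℤP.≤∧≢⇒<
  (subst (_ ℤ.≤_) (sym eq) (step-from-above b (climb-forward unit v<fa avoid m a≤m (ℕP.<⇒≤ m<n))))
  (λ e → avoid (suc m) (s≤s a≤m) m<n (sym e))

climb-backward : ∀ {f n b v} → UnitSteps f n → b ≤ n → v ℤ.< f b → (∀ m → m < b → f m ≢ v) →
  ∀ m → m ≤ b → v ℤ.< f m
climb-backward {f} {n} {b} {v} unit b≤n v<fb avoid m m≤b = go (b ∸ m) m (ℕP.m+[n∸m]≡n m≤b)
  where
  go : ∀ k m → m + k ≡ b → v ℤ.< f m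
  go zero    m eq = subst (λ t → v ℤ.< f t) (sym (trans (sym (ℕP.+-identityʳ m)) eq)) v<fb
  go (suc k) m eq = ℤP.≤∧≢⇒< (step-to-above (proj₁ move) (subst (v ℤ.<_) (proj₂ move) v<f[m+1]))
                              (λ e → avoid m m<b (sym e))
    where
    m<b : m < b
    m<b = subst (m <_) eq (ℕP.m<m+n m (s≤s z≤n))
    move : ∃ λ c → f (suc m) ≡ step c ℤ.+ f m
    move = unit m (ℕP.<-≤-trans m<b b≤n)
    v<f[m+1] : v ℤ.< f (suc m)
    v<f[m+1] = go k (suc m) (trans (sym (ℕP.+-suc m k)) eq)

StaysAbove : (ℕ → ℤ) → ℕ → ℤ → ℕ → Set
StaysAbove f n v e = ∀ m → e < m → m ≤ n → v ℤ.< f m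

lastVisit : ∀ {f n v q} s → q ≤ s → f q ℤ.≤ v → StaysAbove f n v s →
  ∃ λ e → e ≤ s × f e ℤ.≤ v × StaysAbove f n v e
lastVisit {f} {v = v} s q≤s fq≤v above with f s ℤP.≤? v
... | yes fs≤v = s , ℕP.≤-refl , fs≤v , above
... | no  fs≰v with ℕP.m≤n⇒m<n∨m≡n q≤s
...   | inj₂ refl = ⊥-elim (fs≰v fq≤v)
lastVisit {f} {v = v} (suc s) _ fq≤v above | no fs≰v | inj₁ (s≤s q≤s) =
  let e , e≤s , found = lastVisit s q≤s fq≤v above-s in e , ℕP.m≤n⇒m≤1+n e≤s , found
  where
  above-s : StaysAbove f _ v s
  above-s m s<m m≤n with ℕP.m≤n⇒m<n∨m≡n s<m
  ... | inj₁ s+1<m = above m s+1<m m≤n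
  ... | inj₂ refl  = ℤP.≰⇒> fs≰v

ReturnsLater : ∀ {n} → Subset n → Fin n → Set
ReturnsLater z i = ∃ λ j → i F.< j × c z i j ≡ + 0

ReturnsEarlier : ∀ {n} → Subset n → Fin n → Set
ReturnsEarlier z i = ∃ λ j → j F.< i × c z j i ≡ + 0

data SigView {n} (z : Subset n) (i : Fin n) (s : Sym) : Set where
  is1  : i ∈ z →   ReturnsLater z i   → s ≡ s1 → SigView z i s
  is*∈ : i ∈ z → ¬ ReturnsLater z i   → s ≡ s* → SigView z i s
  is0  : i ∉ z →   ReturnsEarlier z i → s ≡ s0 → SigView z i s
  is*∉ : i ∉ z → ¬ ReturnsEarlier z i → s ≡ s* → SigView z i s

sigView : ∀ {n} (z : Subset n) i → SigView z i (sgAt z i)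
sigView z i with i ∈? z
... | yes i∈z with FP.any? (λ j → (i FP.<? j) ×-dec (c z i j ℤP.≟ + 0))
...   | yes later = is1 i∈z later refl
...   | no  never = is*∈ i∈z never refl
sigView z i | no i∉z with FP.any? (λ j → (j FP.<? i) ×-dec (c z j i ℤP.≟ + 0))
...   | yes earlier = is0 i∉z earlier refl
...   | no  never   = is*∉ i∉z never refl

c≡0⇒level : ∀ {n} (z : Subset n) {i j} → i F.≤ j → c z i j ≡ + 0 → height z (suc (toℕ j)) ≡ height z (toℕ i)
c≡0⇒level z i≤j c≡0 = ℤP.i-j≡0⇒i≡j _ _ (trans (sym (c-height z i≤j)) c≡0)

level⇒c≡0 : ∀ {n} (z : Subset n) {i j} → i F.≤ j → height z (suc (toℕ j)) ≡ height z (toℕ i) → c z i j ≡ + 0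
level⇒c≡0 z {i} i≤j level =
  trans (c-height z i≤j) (trans (cong (ℤ._- height z (toℕ i)) level) (ℤP.+-inverseʳ (height z (toℕ i))))

AboveAfter : ∀ {n} → Subset n → ℕ → Set
AboveAfter {n} z a = StaysAbove (height z) n (height z a) a

BelowBefore : ∀ {n} → Subset n → ℕ → Set
BelowBefore z a = ∀ m → m ≤ a → height z (suc a) ℤ.< height z m

star∈⇒aboveAfter : ∀ {n} (z : Subset n) {i} → i ∈ z → IsStar z i → AboveAfter z (toℕ i)
star∈⇒aboveAfter z {i} i∈z star with sigView z i
... | is1 _ _ e      with () ← trans (sym e) star
... | is0  i∉z _ _  = ⊥-elim (i∉z i∈z)
... | is*∉ i∉z _ _  = ⊥-elim (i∉z i∈z)
... | is*∈ _ never _ = climb-forward (height-unitSteps z) up avoid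
  where
  up : height z (toℕ i) ℤ.< height z (suc (toℕ i))
  up = subst (height z (toℕ i) ℤ.<_) (sym (height-step-∈ z i∈z)) (i<suc[i] _)
  avoid : ∀ m → suc (toℕ i) < m → m ≤ _ → height z m ≢ height z (toℕ i)
  avoid (suc m) (s≤s i<m) m<n level =
    never (j , subst (toℕ i <_) (sym j≡m) i<m ,
           level⇒c≡0 z (subst (toℕ i ≤_) (sym j≡m) (ℕP.<⇒≤ i<m)) (subst (λ t → height z (suc t) ≡ _) (sym j≡m) level))
    where
    j : Fin _
    j = fromℕ< m<n
    j≡m : toℕ j ≡ m
    j≡m = FP.toℕ-fromℕ< m<n

aboveAfter⇒star : ∀ {n} (z : Subset n) {i} → i ∈ z → AboveAfter z (toℕ i) → IsStar z i
aboveAfter⇒star z {i} i∈z above with sigView z i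
... | is1 _ (j , i<j , c≡0) _ = ⊥-elim (ℤP.<⇒≢ (above (suc (toℕ j)) (ℕP.m<n⇒m<1+n i<j) (FP.toℕ<n j))
                                              (sym (c≡0⇒level z (ℕP.<⇒≤ i<j) c≡0)))
... | is*∈ _ _ e  = e
... | is0  i∉z _ _ = ⊥-elim (i∉z i∈z)
... | is*∉ i∉z _ _ = ⊥-elim (i∉z i∈z)

star∉⇒belowBefore : ∀ {n} (z : Subset n) {i} → i ∉ z → IsStar z i → BelowBefore z (toℕ i)
star∉⇒belowBefore z {i} i∉z star with sigView z i
... | is0 _ _ e     with () ← trans (sym e) star
... | is1   i∈z _ _  = ⊥-elim (i∉z i∈z)
... | is*∈ i∈z _ _  = ⊥-elim (i∉z i∈z)
... | is*∉ _ never _ = climb-backward (height-unitSteps z) (ℕP.<⇒≤ (FP.toℕ<n i)) down avoid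
  where
  down : height z (suc (toℕ i)) ℤ.< height z (toℕ i)
  down = subst (ℤ._< height z (toℕ i)) (sym (height-step-∉ z i∉z)) (pred[i]<i _)
  avoid : ∀ m → m < toℕ i → height z m ≢ height z (suc (toℕ i))
  avoid m m<i level =
    never (j , subst (_< toℕ i) (sym j≡m) m<i ,
           level⇒c≡0 z (subst (_≤ toℕ i) (sym j≡m) (ℕP.<⇒≤ m<i)) (sym (subst (λ t → height z t ≡ _) (sym j≡m) level)))
    where
    m<n : m < _
    m<n = ℕP.<-trans m<i (FP.toℕ<n i)
    j : Fin _
    j = fromℕ< m<n
    j≡m : toℕ j ≡ m
    j≡m = FP.toℕ-fromℕ< m<n

belowBefore⇒star : ∀ {n} (z : Subset n) {i} → i ∉ z → BelowBefore z (toℕ i) → IsStar z i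
belowBefore⇒star z {i} i∉z below with sigView z i
... | is0 _ (j , j<i , c≡0) _ = ⊥-elim (ℤP.<⇒≢ (below (toℕ j) (ℕP.<⇒≤ j<i)) (c≡0⇒level z (ℕP.<⇒≤ j<i) c≡0))
... | is*∉ _ _ e  = e
... | is1   i∈z _ _ = ⊥-elim (i∉z i∈z)
... | is*∈ i∈z _ _ = ⊥-elim (i∉z i∈z)

sig1⇒∈ : ∀ {n} (z : Subset n) {i} → sgAt z i ≡ s1 → i ∈ z
sig1⇒∈ z {i} sig with sigView z i
... | is1 i∈z _ _   = i∈z
... | is*∈ i∈z _ _ = i∈z
... | is0 _ _ e    with () ← trans (sym sig) e
... | is*∉ _ _ e   with () ← trans (sym sig) e

sig0⇒∉ : ∀ {n} (z : Subset n) {i} → sgAt z i ≡ s0 → i ∉ z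
sig0⇒∉ z {i} sig with sigView z i
... | is0 i∉z _ _  = i∉z
... | is*∉ i∉z _ _ = i∉z
... | is1 _ _ e     with () ← trans (sym sig) e
... | is*∈ _ _ e   with () ← trans (sym sig) e

StarMember : ∀ {n} → Subset n → Fin n → Set
StarMember z i = i ∈ z × IsStar z i

starMember? : ∀ {n} (z : Subset n) → Decidable (StarMember z)
starMember? z i = (i ∈? z) ×-dec isStar? z i

-- Heights at starred members strictly increase; in particular a starred
-- member is determined by its height.
starMember-height-injective : ∀ {n} (z : Subset n) {a b} → StarMember z a → StarMember z b →
  height z (toℕ a) ≡ height z (toℕ b) → a ≡ b
starMember-height-injective z {a} {b} (a∈z , a*) (b∈z , b*) same with FP.<-cmp a b
... | tri< a<b _ _ = ⊥-elim (ℤP.<⇒≢ (star∈⇒aboveAfter z a∈z a* (toℕ b) a<b (ℕP.<⇒≤ (FP.toℕ<n b))) same)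
... | tri≈ _ a≡b _ = a≡b
... | tri> _ _ b<a = ⊥-elim (ℤP.<⇒≢ (star∈⇒aboveAfter z b∈z b* (toℕ a) b<a (ℕP.<⇒≤ (FP.toℕ<n a))) (sym same))

star-after-starMember : ∀ {n} (z : Subset n) {a b} → toℕ a < toℕ b → StarMember z a → IsStar z b → b ∈ z
star-after-starMember z {a} {b} a<b (a∈z , a*) b* = decidable-stable (b ∈? z) λ b∉z →
  ℤP.<-asym (star∈⇒aboveAfter z a∈z a* (suc (toℕ b)) (ℕP.m<n⇒m<1+n a<b) (FP.toℕ<n b))
            (star∉⇒belowBefore z b∉z b* (toℕ a) (ℕP.<⇒≤ a<b))

lastVisit-starMember : ∀ {n} (z : Subset n) {e v} (e<n : e < n) →
  height z e ℤ.≤ v → StaysAbove (height z) n v e →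
  StarMember z (fromℕ< e<n) × height z e ≡ v
lastVisit-starMember {n} z {e} {v} e<n he≤v above = (E∈z , aboveAfter⇒star z E∈z E-above) , ℤP.≤-antisym he≤v v≤he
  where
  E : Fin n
  E = fromℕ< e<n
  E≡e : toℕ E ≡ e
  E≡e = FP.toℕ-fromℕ< e<n
  v<next : v ℤ.< step (bitAt z e) ℤ.+ height z e
  v<next = subst (v ℤ.<_) (height-step z e e<n) (above (suc e) ℕP.≤-refl e<n)
  v≤he : v ℤ.≤ height z e
  v≤he = step-to-above (bitAt z e) v<next
  up : bitAt z e ≡ true
  up with bitAt z e | v<next
  ... | true  | _      = refl
  ... | false | v<he-1 =
    ⊥-elim (ℤP.<-irrefl refl (ℤP.<-≤-trans (ℤP.≤-<-trans he≤v v<he-1) (ℤP.i≤j⇒pred[i]≤j ℤP.≤-refl)))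
  E∈z : E ∈ z
  E∈z = bitAt⇒∈ z E (subst (λ t → bitAt z t ≡ true) (sym E≡e) up)
  E-above : AboveAfter z (toℕ E)
  E-above m E<m m≤n rewrite E≡e = ℤP.≤-<-trans he≤v (above m E<m m≤n)

sgAt-≡ : ∀ {n} (z w : Subset n) i → (i ∈ z → i ∈ w) → (i ∈ w → i ∈ z) →
  (IsStar z i → IsStar w i) → (IsStar w i → IsStar z i) → sgAt z i ≡ sgAt w i
sgAt-≡ z w i z⇒w w⇒z *z⇒*w *w⇒*z = compare (sgAt z i) (sgAt w i) refl refl
  where
  compare : ∀ s t → sgAt z i ≡ s → sgAt w i ≡ t → s ≡ t
  compare s* s* _ _ = refl
  compare s1 s1 _ _ = refl
  compare s0 s0 _ _ = refl
  compare s* s1 z* w1 with () ← trans (sym w1) (*z⇒*w z*)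
  compare s* s0 z* w0 with () ← trans (sym w0) (*z⇒*w z*)
  compare s1 s* z1 w* with () ← trans (sym z1) (*w⇒*z w*)
  compare s0 s* z0 w* with () ← trans (sym z0) (*w⇒*z w*)
  compare s1 s0 z1 w0 = ⊥-elim (sig0⇒∉ w w0 (z⇒w (sig1⇒∈ z z1)))
  compare s0 s1 z0 w1 = ⊥-elim (sig0⇒∉ z z0 (w⇒z (sig1⇒∈ w w1)))

starElems-sorted : ∀ {n} (z : Subset n) → AllPairs F._<_ (starElems z)
starElems-sorted {n} z = APP.filter⁺ (starMember? z) (APP.tabulate⁺-< (λ i<j → i<j))

∈-starElems : ∀ {n} (z : Subset n) {i} → StarMember z i → i ∈ˡ starElems z
∈-starElems z i* = ∈-filter⁺ (starMember? z) (∈-allFin _) i*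

∈-starElems⁻ : ∀ {n} (z : Subset n) {i} → i ∈ˡ starElems z → StarMember z i
∈-starElems⁻ {n} z i∈ = proj₂ (∈-filter⁻ (starMember? z) {xs = allFin n} i∈)

starRank : ∀ {n} → Subset n → Fin n → ℕ
starRank {n} z a = count (λ i → (i F.<? a) ×-dec starMember? z i) (allFin n)

∈-take-starElems⁻ : ∀ {n} (z : Subset n) {a} r → a ∈ˡ take r (starElems z) → StarMember z a × starRank z a < r
∈-take-starElems⁻ {n} z r a∈t =
  let a∈ , below = ∈-take⇒ (starElems-sorted z) r a∈t
  in ∈-starElems⁻ z a∈ , subst (_< r) (count-filter (starMember? z) (F._<? _) (allFin n)) below

∈-take-starElems⁺ : ∀ {n} (z : Subset n) {a} r → StarMember z a → starRank z a < r → a ∈ˡ take r (starElems z)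
∈-take-starElems⁺ {n} z r a* below =
  ∈-take⇐ (starElems-sorted z) r (∈-starElems z a*) (subst (_< r) (sym (count-filter (starMember? z) (F._<? _) (allFin n))) below)

starMember-at-level : ∀ {n} (z : Subset n) → n ≤ 2 * ∣ z ∣ → ∀ v → v < 2 * ∣ z ∣ ∸ n →
  ∃ λ E → StarMember z E × height z (toℕ E) ≡ + v
starMember-at-level {n} z n≤2k v v<h with lastVisit {f = height z} {q = 0} n z≤n (ℤ.+≤+ z≤n) nothing-after
  where
  nothing-after : StaysAbove (height z) n (+ v) n
  nothing-after m n<m m≤n = ⊥-elim (ℕP.<-irrefl refl (ℕP.<-≤-trans n<m m≤n))
... | e , e≤n , he≤v , above with ℕP.m≤n⇒m<n∨m≡n e≤n
...   | inj₁ e<n  = let E* , hE = lastVisit-starMember z e<n he≤v above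
                  in fromℕ< e<n , E* , trans (cong (height z) (FP.toℕ-fromℕ< e<n)) hE
...   | inj₂ refl =
  ⊥-elim (ℤP.<-irrefl refl (ℤP.<-≤-trans (subst (+ v ℤ.<_) (sym (height-final z n≤2k)) (ℤ.+<+ v<h)) he≤v))

-- Distinct levels give distinct starred members, so there are at least 2|z| − n of them.
starElems-length : ∀ {n} (z : Subset n) → n ≤ 2 * ∣ z ∣ → 2 * ∣ z ∣ ∸ n ≤ length (starElems z)
starElems-length {n} z n≤2k = FP.injective⇒≤ {f = position} position-injective
  where
  level : (v : Fin (2 * ∣ z ∣ ∸ n)) → ∃ λ E → StarMember z E × height z (toℕ E) ≡ + toℕ v
  level v = starMember-at-level z n≤2k (toℕ v) (FP.toℕ<n v)
  position : Fin (2 * ∣ z ∣ ∸ n) → Fin (length (starElems z))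
  position v = index (∈-starElems z (proj₁ (proj₂ (level v))))
  position-injective : ∀ {v w} → position v ≡ position w → v ≡ w
  position-injective {v} {w} same = FP.toℕ-injective (ℤP.+-injective (begin
    + toℕ v                           ≡⟨ proj₂ (proj₂ (level v)) ⟨
    height z (toℕ (proj₁ (level v)))  ≡⟨ cong (λ E → height z (toℕ E)) same-member ⟩
    height z (toℕ (proj₁ (level w)))  ≡⟨ proj₂ (proj₂ (level w)) ⟩
    + toℕ w                           ∎))
    where
    open ≡-Reasoning
    same-member : proj₁ (level v) ≡ proj₁ (level w)
    same-member = trans (lookup-index (∈-starElems z (proj₁ (proj₂ (level v)))))
                        (trans (cong (lookup (starElems z)) same)
                               (sym (lookup-index (∈-starElems z (proj₁ (proj₂ (level w)))))))

bitAt-remove-≢ : ∀ {n} (z : Subset n) e m → m ≢ toℕ e → bitAt (z - e) m ≡ bitAt z m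
bitAt-remove-≢ (s ∷ z) F.zero    zero    m≢e = ⊥-elim (m≢e refl)
bitAt-remove-≢ (s ∷ z) F.zero    (suc m) _   = cong (λ t → bitAt t m) (p─⊥≡p z)
bitAt-remove-≢ (true  ∷ z) (F.suc e) zero    _ = refl
bitAt-remove-≢ (false ∷ z) (F.suc e) zero    _ = refl
bitAt-remove-≢ (s ∷ z) (F.suc e) (suc m) m≢e = bitAt-remove-≢ z e m (λ m≡e → m≢e (cong suc m≡e))

bitAt-remove-≡ : ∀ {n} (z : Subset n) e → bitAt (z - e) (toℕ e) ≡ false
bitAt-remove-≡ (s ∷ z) F.zero    = refl
bitAt-remove-≡ (s ∷ z) (F.suc e) = bitAt-remove-≡ z e

∈-remove⁻ : ∀ {n} (z : Subset n) e {i} → i ∈ z - e → i ∈ z × i ≢ e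
∈-remove⁻ z e {i} i∈w =
  p─q⊆p z ⁅ e ⁆ i∈w , λ { refl → true≢false (trans (sym (bitAt-∈ i∈w)) (bitAt-remove-≡ z e)) }
  where
  true≢false : true ≢ false
  true≢false ()

card-remove : ∀ {n} (z : Subset n) {e} → e ∈ z → suc ∣ z - e ∣ ≡ ∣ z ∣
card-remove (inside  ∷ z) here      = cong suc (cong ∣_∣ (p─⊥≡p z))
card-remove (inside  ∷ z) (there p) = cong suc (card-remove z p)
card-remove (outside ∷ z) (there p) = card-remove z p

-- Raising a height by two: the effect of a removed up step on later heights.
up2 : ℤ → ℤ
up2 h = + 2 ℤ.+ h

up2-mono-< : ∀ {a b} → a ℤ.< b → up2 a ℤ.< up2 b
up2-mono-< = ℤP.+-monoʳ-< (+ 2)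

up2-cancel-< : ∀ {a b} → up2 a ℤ.< up2 b → a ℤ.< b
up2-cancel-< {a} {b} lt = subst₂ ℤ._<_ (back a) (back b) (ℤP.+-monoʳ-< (ℤ.- + 2) lt)
  where
  back : ∀ h → ℤ.- + 2 ℤ.+ (+ 2 ℤ.+ h) ≡ h
  back = solve-∀

-- How the walk of w = z - e compares with the walk of z, for a member e of z:
-- equal up to position e, then two lower.
module Removal {n} (z : Subset n) (e : Fin n) (e∈z : e ∈ z) where
  w : Subset n
  w = z - e
  ē : ℕ
  ē = toℕ e

  height-before : ∀ m → m ≤ ē → height w m ≡ height z m
  height-before zero    _   = refl
  height-before (suc m) m<e = begin
    height w (suc m)                       ≡⟨ height-step w m m<n ⟩
    step (bitAt w m) ℤ.+ height w m        ≡⟨ cong₂ (λ b h → step b ℤ.+ h) (bitAt-remove-≢ z e m (ℕP.<⇒≢ m<e))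
                                                                         (height-before m (ℕP.<⇒≤ m<e)) ⟩
    step (bitAt z m) ℤ.+ height z m        ≡⟨ height-step z m m<n ⟨
    height z (suc m)                       ∎
    where
    open ≡-Reasoning
    m<n : m < n
    m<n = ℕP.<-trans m<e (FP.toℕ<n e)

  height-at : height w (suc ē) ≡ ℤ.pred (height z ē)
  height-at = trans (height-step w ē (FP.toℕ<n e))
                    (cong₂ (λ b h → step b ℤ.+ h) (bitAt-remove-≡ z e) (height-before ē ℕP.≤-refl))

  height-after : ∀ m → ē < m → m ≤ n → height z m ≡ up2 (height w m)
  height-after (suc m) (s≤s e≤m) m<n with ℕP.m≤n⇒m<n∨m≡n e≤m
  ... | inj₂ refl = trans (height-step-∈ z e∈z) (trans (suc≡up2∘pred (height z ē)) (cong up2 (sym height-at)))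
    where
    suc≡up2∘pred : ∀ h → 1ℤ ℤ.+ h ≡ + 2 ℤ.+ (-1ℤ ℤ.+ h)
    suc≡up2∘pred = solve-∀
  ... | inj₁ e<m = begin
    height z (suc m)                           ≡⟨ height-step z m m<n ⟩
    step (bitAt z m) ℤ.+ height z m            ≡⟨ cong₂ (λ b h → step b ℤ.+ h) (sym (bitAt-remove-≢ z e m (ℕP.>⇒≢ e<m)))
                                                                             (height-after m e<m (ℕP.<⇒≤ m<n)) ⟩
    step (bitAt w m) ℤ.+ up2 (height w m)      ≡⟨ swap (step (bitAt w m)) (height w m) ⟩
    up2 (step (bitAt w m) ℤ.+ height w m)      ≡⟨ cong up2 (height-step w m m<n) ⟨
    up2 (height w (suc m))                     ∎
    where
    open ≡-Reasoning
    swap : ∀ a h → a ℤ.+ (+ 2 ℤ.+ h) ≡ + 2 ℤ.+ (a ℤ.+ h)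
    swap = solve-∀

  height-≤ : ∀ m → m ≤ n → height w m ℤ.≤ height z m
  height-≤ m m≤n with ℕP.≤-total m ē
  ... | inj₁ m≤e = ℤP.≤-reflexive (height-before m m≤e)
  ... | inj₂ e≤m with ℕP.m≤n⇒m<n∨m≡n e≤m
  ...   | inj₂ refl = ℤP.≤-reflexive (height-before m ℕP.≤-refl)
  ...   | inj₁ e<m  = subst (height w m ℤ.≤_) (sym (height-after m e<m m≤n)) (ℤP.i≤j+i _ (+ 2))

module RemoveFirstStar {n} (z : Subset n) (e : Fin n) (e* : StarMember z e)
                       (first : ∀ d → StarMember z d → toℕ e ≤ toℕ d) where
  open Removal z e (proj₁ e*)

  e-above : AboveAfter z ē
  e-above = star∈⇒aboveAfter z (proj₁ e*) (proj₂ e*)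

  -- e is a (weak) minimum of the walk on [0, e]: an earlier lower point would
  -- produce an earlier starred member by lastVisit-starMember.
  prefix-min : ∀ j → j ≤ ē → height z ē ℤ.≤ height z j
  prefix-min j j≤e = decidable-stable (height z ē ℤP.≤? height z j) λ not-min →
    let v = ℤ.pred (height z ē)
        d , d≤e , hd≤v , above = lastVisit {q = j} ē j≤e (ℤP.i<j⇒i≤pred[j] (ℤP.≰⇒> not-min))
                                           (λ m e<m m≤n → ℤP.<-trans (pred[i]<i _) (e-above m e<m m≤n))
    in case-last d d≤e hd≤v above
    where
    case-last : ∀ d → d ≤ ē → height z d ℤ.≤ ℤ.pred (height z ē) →
      StaysAbove (height z) n (ℤ.pred (height z ē)) d → ⊥
    case-last d d≤e hd≤v above with ℕP.m≤n⇒m<n∨m≡n d≤e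
    ... | inj₂ refl = ℤP.<-irrefl refl (ℤP.≤-<-trans hd≤v (pred[i]<i _))
    ... | inj₁ d<e  = ℕP.<-irrefl refl (ℕP.<-≤-trans (subst (_< ē) (sym (FP.toℕ-fromℕ< d<n)) d<e)
                                                   (first _ (proj₁ (lastVisit-starMember z d<n hd≤v above))))
      where
      d<n : d < n
      d<n = ℕP.<-trans d<e (FP.toℕ<n e)

  -- At e itself the down step of z - e reaches a new low, so e stays a star.
  sig-at : sgAt w e ≡ sgAt z e
  sig-at = trans (belowBefore⇒star w e∉w below) (sym (proj₂ e*))
    where
    e∉w : e ∉ w
    e∉w e∈w = proj₂ (∈-remove⁻ z e e∈w) refl
    below : BelowBefore w ē
    below m m≤e = subst₂ ℤ._<_ (sym height-at) (sym (height-before m m≤e))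
                         (ℤP.<-≤-trans (pred[i]<i _) (prefix-min m m≤e))

  -- Before e the walks agree, and members there are never starred in z.
  module Before {i : Fin n} (i<e : toℕ i < ē) where
    ī = toℕ i
    i≢e : i ≢ e
    i≢e = FP.<⇒≢ i<e
    not-starred : i ∈ z → ¬ IsStar z i
    not-starred i∈z i* = ℕP.<-irrefl refl (ℕP.<-≤-trans i<e (first i (i∈z , i*)))

    star-w⇒z : Dec (i ∈ z) → IsStar w i → IsStar z i
    star-w⇒z (yes i∈z) i* = aboveAfter⇒star z i∈z λ m i<m m≤n →
      subst (ℤ._< height z m) (height-before ī (ℕP.<⇒≤ i<e))
            (ℤP.<-≤-trans (star∈⇒aboveAfter w (x∈p∧x≢y⇒x∈p-y i∈z i≢e) i* m i<m m≤n) (height-≤ m m≤n))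
    star-w⇒z (no i∉z) i* = belowBefore⇒star z i∉z λ m m≤i →
      subst₂ ℤ._<_ (height-before (suc ī) i<e) (height-before m (ℕP.≤-trans m≤i (ℕP.<⇒≤ i<e)))
             (star∉⇒belowBefore w (λ i∈w → i∉z (proj₁ (∈-remove⁻ z e i∈w))) i* m m≤i)

    star-z⇒w : Dec (i ∈ z) → IsStar z i → IsStar w i
    star-z⇒w (yes i∈z) i* = ⊥-elim (not-starred i∈z i*)
    star-z⇒w (no i∉z) i* = belowBefore⇒star w (λ i∈w → i∉z (proj₁ (∈-remove⁻ z e i∈w))) λ m m≤i →
      subst₂ ℤ._<_ (sym (height-before (suc ī) i<e)) (sym (height-before m (ℕP.≤-trans m≤i (ℕP.<⇒≤ i<e))))
             (star∉⇒belowBefore z i∉z i* m m≤i)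

    sig : sgAt w i ≡ sgAt z i
    sig = sgAt-≡ w z i (λ i∈w → proj₁ (∈-remove⁻ z e i∈w)) (λ i∈z → x∈p∧x≢y⇒x∈p-y i∈z i≢e)
                 (star-w⇒z (i ∈? z)) (star-z⇒w (i ∈? z))

  -- After e the walk of z - e is the walk of z shifted down by two, and
  -- non-members there are starred in neither set.
  module After {i : Fin n} (e<i : ē < toℕ i) where
    ī = toℕ i
    i≢e : i ≢ e
    i≢e i≡e = ℕP.>⇒≢ e<i (cong toℕ i≡e)
    i∈w : i ∈ z → i ∈ w
    i∈w i∈z = x∈p∧x≢y⇒x∈p-y i∈z i≢e
    i∉w : i ∉ z → i ∉ w
    i∉w i∉z i∈w = i∉z (proj₁ (∈-remove⁻ z e i∈w))
    shift : ∀ m → ī ≤ m → m ≤ n → height z m ≡ up2 (height w m)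
    shift m i≤m m≤n = height-after m (ℕP.<-≤-trans e<i i≤m) m≤n

    no-star-z : i ∉ z → ¬ IsStar z i
    no-star-z i∉z i* = ℤP.<-asym (e-above (suc ī) (ℕP.m<n⇒m<1+n e<i) (FP.toℕ<n i))
                                 (star∉⇒belowBefore z i∉z i* ē (ℕP.<⇒≤ e<i))

    no-star-w : i ∉ z → ¬ IsStar w i
    no-star-w i∉z i* = ℤP.<-irrefl refl (ℤP.<-≤-trans (e-above (suc ī) (ℕP.m<n⇒m<1+n e<i) (FP.toℕ<n i))
                                                      (step-to-above true below-e+1))
      where
      below-e+1 : height z (suc ī) ℤ.< ℤ.suc (height z ē)
      below-e+1 = subst₂ ℤ._<_ (sym (shift (suc ī) (ℕP.n≤1+n ī) (FP.toℕ<n i)))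
                               (trans (sym (height-after (suc ē) ℕP.≤-refl (FP.toℕ<n e))) (height-step-∈ z (proj₁ e*)))
                               (up2-mono-< (star∉⇒belowBefore w (i∉w i∉z) i* (suc ē) e<i))

    star-w⇒z : Dec (i ∈ z) → IsStar w i → IsStar z i
    star-w⇒z (yes i∈z) i* = aboveAfter⇒star z i∈z λ m i<m m≤n →
      subst₂ ℤ._<_ (sym (shift ī ℕP.≤-refl (ℕP.<⇒≤ (FP.toℕ<n i)))) (sym (shift m (ℕP.<⇒≤ i<m) m≤n))
             (up2-mono-< (star∈⇒aboveAfter w (i∈w i∈z) i* m i<m m≤n))
    star-w⇒z (no i∉z) i* = ⊥-elim (no-star-w i∉z i*)

    star-z⇒w : Dec (i ∈ z) → IsStar z i → IsStar w i
    star-z⇒w (yes i∈z) i* = aboveAfter⇒star w (i∈w i∈z) λ m i<m m≤n →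
      up2-cancel-< (subst₂ ℤ._<_ (shift ī ℕP.≤-refl (ℕP.<⇒≤ (FP.toℕ<n i))) (shift m (ℕP.<⇒≤ i<m) m≤n)
                                 (star∈⇒aboveAfter z i∈z i* m i<m m≤n))
    star-z⇒w (no i∉z) i* = ⊥-elim (no-star-z i∉z i*)

    sig : sgAt w i ≡ sgAt z i
    sig = sgAt-≡ w z i (λ i∈w → proj₁ (∈-remove⁻ z e i∈w)) i∈w (star-w⇒z (i ∈? z)) (star-z⇒w (i ∈? z))

  signature-kept : ∀ i → sgAt w i ≡ sgAt z i
  signature-kept i with FP.<-cmp i e
  ... | tri< i<e _ _    = Before.sig i<e
  ... | tri≈ _ refl _   = sig-at
  ... | tri> _ _ e<i    = After.sig e<i

-- Removing an arbitrary member b of x: starred members of x - b were already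
-- starred in x, and conversely a starred member i ≠ b of x stays starred
-- unless its height is one below that of b.
module RemoveMember {n} (x : Subset n) (b : Fin n) (b∈x : b ∈ x) where
  open Removal x b b∈x renaming (w to y)

  starMember⁻ : ∀ {a} → StarMember y a → StarMember x a
  starMember⁻ {a} (a∈y , a*) = a∈x , aboveAfter⇒star x a∈x above-x
    where
    a∈x = proj₁ (∈-remove⁻ x b a∈y)
    above-y = star∈⇒aboveAfter y a∈y a*
    above-x : AboveAfter x (toℕ a)
    above-x m a<m m≤n with FP.<-cmp a b
    ... | tri< a<b _ _ = subst (ℤ._< height x m) (height-before (toℕ a) (ℕP.<⇒≤ a<b))
                               (ℤP.<-≤-trans (above-y m a<m m≤n) (height-≤ m m≤n))
    ... | tri≈ _ a≡b _ = ⊥-elim (proj₂ (∈-remove⁻ x b a∈y) a≡b)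
    ... | tri> _ _ b<a = subst₂ ℤ._<_ (sym (height-after (toℕ a) b<a (ℕP.<⇒≤ (FP.toℕ<n a))))
                                      (sym (height-after m (ℕP.<-trans b<a a<m) m≤n))
                                      (up2-mono-< (above-y m a<m m≤n))

  starMember⁺ : StarMember x b → ∀ {i} → StarMember x i → i ≢ b →
    ℤ.suc (height x (toℕ i)) ≢ height x ē → StarMember y i
  starMember⁺ (_ , b*) {i} (i∈x , i*) i≢b not-just-below = i∈y , aboveAfter⇒star y i∈y above-y
    where
    i∈y = x∈p∧x≢y⇒x∈p-y i∈x i≢b
    above-x = star∈⇒aboveAfter x i∈x i*
    above-y : AboveAfter y (toℕ i)
    above-y m i<m m≤n with FP.<-cmp i b
    ... | tri≈ _ i≡b _ = ⊥-elim (i≢b i≡b)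
    ... | tri> _ _ b<i = up2-cancel-< (subst₂ ℤ._<_ (height-after (toℕ i) b<i (ℕP.<⇒≤ (FP.toℕ<n i)))
                                                    (height-after m (ℕP.<-trans b<i i<m) m≤n) (above-x m i<m m≤n))
    ... | tri< i<b _ _ with ℕP.≤-total m ē
    ...   | inj₁ m≤b = subst₂ ℤ._<_ (sym (height-before (toℕ i) (ℕP.<⇒≤ i<b))) (sym (height-before m m≤b))
                              (above-x m i<m m≤n)
    ...   | inj₂ b≤m with ℕP.m≤n⇒m<n∨m≡n b≤m
    ...     | inj₂ refl = subst₂ ℤ._<_ (sym (height-before (toℕ i) (ℕP.<⇒≤ i<b))) (sym (height-before m ℕP.≤-refl))
                                (above-x m i<m m≤n)
    ...     | inj₁ b<m  = subst (ℤ._< height y m) (sym (height-before (toℕ i) (ℕP.<⇒≤ i<b)))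
                            (up2-cancel-< (subst (up2 (height x (toℕ i)) ℤ.<_) (height-after m b<m m≤n)
                                                 (ℤP.≤-<-trans two-below (star∈⇒aboveAfter x b∈x b* m b<m m≤n))))
      where
      suc-suc : ∀ h → 1ℤ ℤ.+ (1ℤ ℤ.+ h) ≡ + 2 ℤ.+ h
      suc-suc = solve-∀
      -- i lies strictly below b in height, and not just one below, hence two below.
      two-below : up2 (height x (toℕ i)) ℤ.≤ height x ē
      two-below = subst (ℤ._≤ height x ē) (suc-suc (height x (toℕ i)))
        (ℤP.i<j⇒suc[i]≤j (ℤP.≤∧≢⇒< (ℤP.i<j⇒suc[i]≤j (above-x ē i<b (ℕP.<⇒≤ (FP.toℕ<n b)))) not-just-below))

  -- Removing a starred member b lowers the number of starred members before
  -- any position by at most two: only b and the starred member one below b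
  -- in height can be lost.
  starRank-remove : StarMember x b → ∀ a → starRank x a ≤ starRank y a + 2
  starRank-remove b* a = begin
    starRank x a                          ≤⟨ count-cover (λ i → (i F.<? a) ×-dec starMember? x i)
                                                         (λ i → (i F.<? a) ×-dec starMember? y i)
                                                         lost? kept-or-lost (allFin n) ⟩
    starRank y a + count lost? (allFin n) ≤⟨ ℕP.+-monoʳ-≤ (starRank y a) at-most-two-lost ⟩
    starRank y a + 2                      ∎
    where
    open ℕP.≤-Reasoning
    JustBelow : Fin n → Set
    JustBelow i = StarMember x i × ℤ.suc (height x (toℕ i)) ≡ height x ē
    just-below? : Decidable JustBelow
    just-below? i = starMember? x i ×-dec (ℤ.suc (height x (toℕ i)) ℤP.≟ height x ē)
    lost? : Decidable (λ i → b ≡ i ⊎ JustBelow i)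
    lost? i = (b FP.≟ i) ⊎-dec just-below? i
    kept-or-lost : ∀ {i} → i F.< a × StarMember x i → (i F.< a × StarMember y i) ⊎ (b ≡ i ⊎ JustBelow i)
    kept-or-lost {i} (i<a , i*) with b FP.≟ i | ℤ.suc (height x (toℕ i)) ℤP.≟ height x ē
    ... | yes b≡i | _        = inj₂ (inj₁ b≡i)
    ... | no _    | yes just = inj₂ (inj₂ (i* , just))
    ... | no b≢i  | no ¬just = inj₁ (i<a , starMember⁺ b* i* (λ i≡b → b≢i (sym i≡b)) ¬just)
    same-level : ∀ {i j} → JustBelow i → JustBelow j → i ≡ j
    same-level (i* , hi) (j* , hj) = starMember-height-injective x i* j* (sucℤ-injective (trans hi (sym hj)))
    at-most-two-lost : count lost? (allFin n) ≤ 2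
    at-most-two-lost = ℕP.≤-trans (count-cover lost? (b FP.≟_) just-below? (λ l → l) (allFin n))
      (ℕP.+-mono-≤ (count-≤1 (b FP.≟_) (λ b≡i b≡j → trans (sym b≡i) b≡j) (allFin⁺ n))
                   (count-≤1 just-below? same-level (allFin⁺ n)))

module FirstStar {n} (z : Subset n) (e : Fin n) (rest : List (Fin n)) (eq : starElems z ≡ e ∷ rest) where
  e* : StarMember z e
  e* = ∈-starElems⁻ z (subst (e ∈ˡ_) (sym eq) (here refl))

  first : ∀ d → StarMember z d → toℕ e ≤ toℕ d
  first d d* with subst (d ∈ˡ_) eq (∈-starElems z d*) | subst (AllPairs F._<_) eq (starElems-sorted z)
  ... | here refl | _         = ℕP.≤-refl
  ... | there d∈  | e<rest ∷ _ = ℕP.<⇒≤ (All.lookup e<rest d∈)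

  open RemoveFirstStar z e e* first public using (signature-kept)

  starElems-remove : starElems (z - e) ≡ rest
  starElems-remove = filter-drop-head (starMember? z) (starMember? (z - e)) (allFin⁺ n) eq
    (λ {a} (a∈w , a*) → let a∈z , a≢e = ∈-remove⁻ z e a∈w in (a∈z , trans (sym (signature-kept a)) a*) , a≢e)
    (λ {a} (a∈z , a*) a≢e → x∈p∧x≢y⇒x∈p-y a∈z a≢e , trans (signature-kept a) a*)

stripStars : ∀ {n} → ℕ → Subset n → Subset n
stripStars zero    z = z
stripStars (suc r) z with starElems z
... | []    = z
... | e ∷ _ = stripStars r (z - e)

strip-signature : ∀ {n} r (z : Subset n) i → sgAt (stripStars r z) i ≡ sgAt z i
strip-signature zero    z i = refl
strip-signature (suc r) z i with starElems z in eq
... | []     = refl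
... | e ∷ es = trans (strip-signature r (z - e) i) (FirstStar.signature-kept z e es eq i)

∈-strip⁻ : ∀ {n} r (z : Subset n) {a} → a ∈ stripStars r z → a ∈ z × ¬ a ∈ˡ take r (starElems z)
∈-strip⁻ zero    z a∈ = a∈ , λ ()
∈-strip⁻ (suc r) z {a} a∈ with starElems z in eq
... | []     = a∈ , λ ()
... | e ∷ es with ∈-strip⁻ r (z - e) a∈
...   | a∈w , a∉taken with ∈-remove⁻ z e a∈w
...     | a∈z , a≢e = a∈z , λ where
  (here a≡e)  → a≢e a≡e
  (there a∈t) → a∉taken (subst (λ l → a ∈ˡ take r l) (sym (FirstStar.starElems-remove z e es eq)) a∈t)

∈-strip⁺ : ∀ {n} r (z : Subset n) {a} → a ∈ z → ¬ a ∈ˡ take r (starElems z) → a ∈ stripStars r z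
∈-strip⁺ zero    z a∈z _ = a∈z
∈-strip⁺ (suc r) z {a} a∈z a∉taken with starElems z in eq
... | []     = a∈z
... | e ∷ es = ∈-strip⁺ r (z - e) (x∈p∧x≢y⇒x∈p-y a∈z (λ a≡e → a∉taken (here a≡e)))
                 (λ a∈t → a∉taken (there (subst (λ l → a ∈ˡ take r l) (FirstStar.starElems-remove z e es eq) a∈t)))

card-strip : ∀ {n} r (z : Subset n) → r ≤ length (starElems z) → r + ∣ stripStars r z ∣ ≡ ∣ z ∣
card-strip zero    z _ = refl
card-strip (suc r) z r<len with starElems z in eq
... | e ∷ es = trans (cong suc (card-strip r (z - e) r≤len)) (card-remove z (proj₁ (FirstStar.e* z e es eq)))
  where
  r≤len : r ≤ length (starElems (z - e))
  r≤len = subst (λ l → r ≤ length l) (sym (FirstStar.starElems-remove z e es eq)) (ℕP.≤-pred r<len)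

∼⇒sgAt : ∀ {n} {z w : Subset n} → z ∼ w → ∀ i → sgAt z i ≡ sgAt w i
∼⇒sgAt {z = z} {w} z∼w i =
  trans (sym (lookup∘tabulate (sgAt z) i)) (trans (cong (λ v → V.lookup v i) z∼w) (lookup∘tabulate (sgAt w) i))

complement-size : ∀ {k p r n} → r + p ≡ k → r + n ≡ k + k → k + p ≡ n
complement-size {k} {p} {r} {n} r+p≡k r+n≡2k = ℕP.+-cancelˡ-≡ r _ _ (begin
  r + (k + p)   ≡⟨ ℕP.+-assoc r k p ⟨
  (r + k) + p   ≡⟨ cong (_+ p) (ℕP.+-comm r k) ⟩
  (k + r) + p   ≡⟨ ℕP.+-assoc k r p ⟩
  k + (r + p)   ≡⟨ cong (ℕ._+_ k) r+p≡k ⟩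
  k + k         ≡⟨ r+n≡2k ⟨
  r + n         ∎)
  where open ≡-Reasoning

stripStars-isP : ∀ {n} (z : Subset n) → n ≤ 2 * ∣ z ∣ → IsP z (stripStars (2 * ∣ z ∣ ∸ n) z)
stripStars-isP {n} z n≤2k = tabulate-cong (strip-signature r z) , complement-size (card-strip r z (starElems-length z n≤2k)) r+n≡2k
  where
  r = 2 * ∣ z ∣ ∸ n
  r+n≡2k : r + n ≡ ∣ z ∣ + ∣ z ∣
  r+n≡2k = trans (ℕP.m∸n+n≡m n≤2k) (cong (ℕ._+_ ∣ z ∣) (ℕP.+-identityʳ ∣ z ∣))

-- If w ⊆ z has the signature of z and misses a starred member b of z, then w
-- also misses every starred member of z up to b, so z has room for all of them.
starRank-room : ∀ {n} (w z : Subset n) → (∀ i → sgAt w i ≡ sgAt z i) → w ⊆ z →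
  ∀ {b} → StarMember z b → b ∉ w → ∣ w ∣ + suc (starRank z b) ≤ ∣ z ∣
starRank-room {n} w z same-sig w⊆z {b} b* b∉w = begin
  ∣ w ∣ + suc (starRank z b)                     ≡⟨ cong₂ (λ p q → p + suc q) (sym (card-count w)) refl ⟩
  count (_∈? w) (allFin n) + suc (starRank z b)  ≤⟨ ℕP.+-monoʳ-≤ (count (_∈? w) (allFin n)) up-to-b ⟩
  count (_∈? w) (allFin n) + count upTo? (allFin n)
    ≤⟨ count-disjoint (_∈? w) upTo? (_∈? z) missed in-z (allFin n) ⟩
  count (_∈? z) (allFin n)                       ≡⟨ card-count z ⟩
  ∣ z ∣                                          ∎
  where
  open ℕP.≤-Reasoning
  upTo? : Decidable (λ i → i F.≤ b × StarMember z i)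
  upTo? i = (i F.≤? b) ×-dec starMember? z i
  b*w : IsStar w b
  b*w = trans (same-sig b) (proj₂ b*)
  in-z : ∀ {i} → i ∈ w ⊎ (i F.≤ b × StarMember z i) → i ∈ z
  in-z (inj₁ i∈w)            = w⊆z i∈w
  in-z (inj₂ (_ , i∈z , _)) = i∈z
  missed : ∀ {i} → i ∈ w → i F.≤ b × StarMember z i → ⊥
  missed {i} i∈w (i≤b , _ , i*) with ℕP.m≤n⇒m<n∨m≡n i≤b
  ... | inj₁ i<b = b∉w (star-after-starMember w i<b (i∈w , trans (same-sig i) i*) b*w)
  ... | inj₂ i≡b = b∉w (subst (_∈ w) (FP.toℕ-injective i≡b) i∈w)
  up-to : ∀ {i} → (i F.< b × StarMember z i) ⊎ b ≡ i → i F.≤ b × StarMember z i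
  up-to (inj₁ (i<b , i*)) = ℕP.<⇒≤ i<b , i*
  up-to (inj₂ refl)       = ℕP.≤-refl , b*
  up-to-b : suc (starRank z b) ≤ count upTo? (allFin n)
  up-to-b = ℕP.≤-trans (ℕP.≤-trans (ℕP.≤-reflexive (ℕP.+-comm 1 (starRank z b)))
                                   (ℕP.+-monoʳ-≤ (starRank z b) (filter-some (b FP.≟_) (∈-allFin b))))
                       (count-disjoint (λ i → (i F.<? b) ×-dec starMember? z i) (b FP.≟_) upTo?
                                       (λ (i<b , _) b≡i → FP.<-irrefl (sym b≡i) i<b)
                                       up-to (allFin n))

room⇒rank-bound : ∀ {p s k n} → p + suc s ≤ k → k + p ≡ n → s < 2 * k ∸ n
room⇒rank-bound {p} {s} {k} {n} room k+p≡n = begin-strict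
  s                          <⟨ ℕP.n<1+n s ⟩
  suc s                      ≡⟨ ℕP.m+n∸m≡n p (suc s) ⟨
  (p + suc s) ∸ p            ≤⟨ ℕP.∸-monoˡ-≤ p room ⟩
  k ∸ p                      ≡⟨ ℕP.[m+n]∸[m+o]≡n∸o k k p ⟨
  (k + k) ∸ (k + p)          ≡⟨ cong₂ _∸_ (cong (ℕ._+_ k) (sym (ℕP.+-identityʳ k))) k+p≡n ⟩
  2 * k ∸ n                  ∎
  where open ℕP.≤-Reasoning

-- Direction (⇒): if x - b precedes x, then p(x) ⊆ x - b has the signature of x
-- and misses b, so b is starred and preceded by fewer than 2|x| − n starred members.
prec⇒early-star : ∀ {n} (x : Subset n) {b} → b ∈ x → (x - b) ≺ x → b ∈ˡ take (2 * ∣ x ∣ ∸ n) (starElems x)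
prec⇒early-star {n} x {b} b∈x (_ , px , _ , (px∼x , sizes) , _ , px⊆py , py⊆y , _) =
  ∈-take-starElems⁺ x (2 * ∣ x ∣ ∸ n) b* (room⇒rank-bound (starRank-room px x same-sig px⊆x b* b∉px) sizes)
  where
  same-sig : ∀ i → sgAt px i ≡ sgAt x i
  same-sig = ∼⇒sgAt px∼x
  px⊆x : px ⊆ x
  px⊆x a∈px = p─q⊆p x ⁅ b ⁆ (py⊆y (px⊆py a∈px))
  b∉px : b ∉ px
  b∉px b∈px = proj₂ (∈-remove⁻ x b (py⊆y (px⊆py b∈px))) refl
  -- b ∈ x rules out the symbol 0, and b ∉ p(x) rules out the symbol 1.
  b-star : ∀ s → sgAt x b ≡ s → IsStar x b
  b-star s* b* = b*
  b-star s1 b1 = ⊥-elim (b∉px (sig1⇒∈ px (trans (same-sig b) b1)))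
  b-star s0 b0 = ⊥-elim (sig0⇒∉ x b0 b∈x)
  b* : StarMember x b
  b* = b∈x , b-star (sgAt x b) refl

-- If b is among the first r + 2 starred members of x, then stripping r + 2
-- starred members from x gives a subset of x - b stripped of r: a starred
-- member among the first r of x - b is among the first r + 2 of x.
strip-nested : ∀ {n} (x : Subset n) {b} r → b ∈ x → b ∈ˡ take (r + 2) (starElems x) →
  stripStars (r + 2) x ⊆ stripStars r (x - b)
strip-nested x {b} r b∈x b-early {a} a∈px = ∈-strip⁺ r (x - b) a∈y a-late-in-y
  where
  a∈x = proj₁ (∈-strip⁻ (r + 2) x a∈px)
  a-late = proj₂ (∈-strip⁻ (r + 2) x a∈px)
  a∈y : a ∈ x - b
  a∈y = x∈p∧x≢y⇒x∈p-y a∈x (λ { refl → a-late b-early })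
  a-late-in-y : ¬ a ∈ˡ take r (starElems (x - b))
  a-late-in-y a-early =
    let a*y , rank-y = ∈-take-starElems⁻ (x - b) r a-early
    in a-late (∈-take-starElems⁺ x (r + 2) (RemoveMember.starMember⁻ x b b∈x a*y)
                 (ℕP.≤-<-trans (RemoveMember.starRank-remove x b b∈x (proj₁ (∈-take-starElems⁻ x (r + 2) b-early)) a)
                               (ℕP.+-monoˡ-< 2 rank-y)))

-- Direction (⇐): if b is among the first 2|x| − n starred members of x, then
-- p(x) and p(x - b) obtained by stripping starred members witness x - b ≺ x.
early-star⇒prec : ∀ {n} (x : Subset n) {b} → n + 2 ≤ 2 * ∣ x ∣ → b ∈ x →
  b ∈ˡ take (2 * ∣ x ∣ ∸ n) (starElems x) → (x - b) ≺ x
early-star⇒prec {n} x {b} n+2≤2k b∈x b-early =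
  y≢x , px , py , stripStars-isP x n≤2k , stripStars-isP y n≤2k′ , px⊆py , py⊆y , p─q⊆p x ⁅ b ⁆
  where
  y = x - b
  r′ = 2 * ∣ y ∣ ∸ n
  n≤2k : n ≤ 2 * ∣ x ∣
  n≤2k = ℕP.≤-trans (ℕP.m≤m+n n 2) n+2≤2k
  2k≡2+2k′ : 2 * ∣ x ∣ ≡ 2 + 2 * ∣ y ∣
  2k≡2+2k′ = trans (cong (2 *_) (sym (card-remove x b∈x))) (ℕP.*-suc 2 ∣ y ∣)
  n≤2k′ : n ≤ 2 * ∣ y ∣
  n≤2k′ = ℕP.+-cancelˡ-≤ 2 n _ (subst₂ _≤_ (ℕP.+-comm n 2) 2k≡2+2k′ n+2≤2k)
  r≡r′+2 : 2 * ∣ x ∣ ∸ n ≡ r′ + 2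
  r≡r′+2 = trans (cong (_∸ n) 2k≡2+2k′) (trans (ℕP.+-∸-assoc 2 n≤2k′) (ℕP.+-comm 2 r′))
  px = stripStars (2 * ∣ x ∣ ∸ n) x
  py = stripStars r′ y
  y≢x : ¬ y ≡ x
  y≢x y≡x = proj₂ (∈-remove⁻ x b (subst (b ∈_) (sym y≡x) b∈x)) refl
  px⊆py : px ⊆ py
  px⊆py = subst (λ r → stripStars r x ⊆ py) (sym r≡r′+2)
                (strip-nested x r′ b∈x (subst (λ r → b ∈ˡ take r (starElems x)) r≡r′+2 b-early))
  py⊆y : py ⊆ y
  py⊆y a∈py = proj₁ (∈-strip⁻ r′ y a∈py)

proposition2p3 : ∀ (n k : ℕ) → n + 2 ≤ 2 * k → (x : Subset n) → ∣ x ∣ ≡ k →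
    (b : Fin n) → b ∈ x →
    ((x - b) ≺ x) ⇔ (b ∈ˡ take (2 * k ∸ n) (starElems x))
proposition2p3 n k n+2≤2k x refl b b∈x = mk⇔ (prec⇒early-star x b∈x) (early-star⇒prec x n+2≤2k b∈x)
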